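{- Let $h \ge 2$ and $k \ge 3$ be integers. For every integer $i_0 \in [0,h-2]$, the set $\mathcal{R}_{\mathbf{Z}}(h,k)$ contains the arithmetic progression \[ \left\{ (i_0+1)b + (h-i_0)(h(k-2)+1) - \frac{(h+i_0+1)(h-i_0)(k-2)}{2} \;:\; b \in \left[(h-i_0)(k-2) - (k-3),\ (h-i_0)(k-2)\right] \right\}. \] In particular, $\mathcal{R}_{\mathbf{Z}}(h,k)$ contains the integer interval \[ \left[ \frac{h^2(k-2)}{2} + \frac{hk}{2} - k + 3,\ \frac{h^2(k-2)}{2} + \frac{hk}{2} \right]. \]
   Context: For real numbers $u\le v$, $[u,v]$ denotes the integer interval $\{n\in\mathbf{Z}: u\le n\le v\}$. For a nonempty set $A$ of integers and a positive integer $h$, $hA$ denotes the set of all sums of $h$ not necessarily distinct elements of $A$. The sumset size set is $\mathcal{R}_{\mathbf{Z}}(h,k) = \{ |hA| : A \subseteq \mathbf{Z},\ |A| = k \}$. -}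

module Defs where

open import Data.Nat using (ℕ)
open import Data.Integer using (ℤ; +_; _+_; 0ℤ)
open import Data.List using (List; length; foldr)
open import Data.List.Membership.Propositional using (_∈_)
open import Data.List.Relation.Unary.All using (All)
open import Data.List.Relation.Unary.Unique.Propositional using (Unique)
open import Data.Product using (Σ; _×_; ∃)
open import Function.Bundles using (_⇔_)
open import Relation.Binary.PropositionalEquality using (_≡_)

sumℤ : List ℤ → ℤ
sumℤ = foldr _+_ 0ℤ

-- n ∈ hA : n is a sum of h (not necessarily distinct) elements of A
InSumset : ℕ → List ℤ → ℤ → Set
InSumset h A n = Σ (List ℤ) λ xs → length xs ≡ h × All (_∈ A) xs × sumℤ xs ≡ n

HasSize : (ℤ → Set) → ℕ → Set
HasSize P m = Σ (List ℤ) λ L → Unique L × length L ≡ m × (∀ n → (n ∈ L) ⇔ P n)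

IsSetOfSize : List ℤ → ℕ → Set
IsSetOfSize A k = Unique A × length A ≡ k

-- m ∈ R_Z(h,k) = { |hA| : A ⊆ Z, |A| = k }
InRZ : ℕ → ℕ → ℕ → Set
InRZ h k m = Σ (List ℤ) λ A → IsSetOfSize A k × HasSize (InSumset h A) m

InRZℤ : ℕ → ℕ → ℤ → Set
InRZℤ h k n = Σ ℕ λ m → n ≡ + m × InRZ h k m

{-# OPTIONS --safe #-}

-- Take A = {0, …, c} ∪ {b} with c = k − 2 < b.  A sum of h elements of A containing j copies
-- of b ranges exactly over the block [jb, jb + (h − j)c], so hA is the union of these blocks.
-- Write h = q + r with rc < b ≤ (r + 1)c + 1.  Since c ≤ b, the blocks with j ≤ q end no later
-- than block q, at qb + rc, and since b ≤ (r + 1)c + 1 each of them overlaps or abuts the next,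
-- so together they fill [0, qb + rc]; the r blocks with j > q lie above it and are pairwise
-- separated because rc < b.  Hence |hA| = qb + rc + 1 + Σ_{u<r} (uc + 1), which for q = i₀ + 1
-- is the paper's progression in b.  For i₀ = 0 its step is 1, so every n of the interval is
-- attained, with b = n − Σ_{u<h} (uc + 1).
module Submission where

open import Defs
open import Data.Nat using (ℕ; zero; suc; _≤_; _<_; z≤n; s≤s; _≤?_; _⊓_; _∸_) renaming (_+_ to _+ℕ_; _*_ to _*ℕ_)
open import Data.Nat.Properties as ℕ
  using (≤-trans; <-≤-trans; ≤-<-trans; ≤-reflexive; <⇒≤; <⇒≱; ≰⇒>; ≤-pred; n≤1+n; m≤m+n; m≤n+m;
         +-monoʳ-≤; +-monoˡ-≤; +-mono-≤; +-monoʳ-<; *-monoˡ-≤; *-monoʳ-≤; +-suc; +-assoc; +-comm;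
         +-cancelˡ-≡; +-cancelˡ-≤; suc-injective; m≤n⇒∃[o]m+o≡n; m≤n⇒m<n∨m≡n; m≤n⇒m≤1+n; m⊓n≤m; m⊓n+n∸m≡n; m≤n+o⇒m∸n≤o)
open import Data.Integer using (ℤ; +_; _+_; _-_; _*_; 0ℤ; +≤+) renaming (_≤_ to _≤ℤ_)
open import Data.Integer.Properties
  using (+-injective; pos-*; +-inverseʳ; +-identityʳ; *-cancelˡ-≡; *-cancelˡ-≤-pos; i≤j⇒0≤j-i; 0≤i-j⇒j≤i)
open import Data.List using (List; []; _∷_; _++_; length; map; upTo)
open import Data.List.Properties using (length-++; length-map; length-upTo)
open import Data.List.Membership.Propositional using (_∈_)
open import Data.List.Membership.Propositional.Properties using (∈-map⁺; ∈-map⁻; ∈-upTo⁺; ∈-upTo⁻; ++-∈⇔)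
open import Data.List.Relation.Unary.All using (All; []; _∷_; tabulate)
open import Data.List.Relation.Unary.AllPairs using ([]; _∷_)
open import Data.List.Relation.Unary.Any using (here; there)
import Data.List.Relation.Unary.Unique.Propositional.Properties as Unique
open import Data.Empty using (⊥)
open import Data.Product using (∃; ∃₂; _×_; _,_)
open import Data.Sum using (_⊎_; inj₁; inj₂; [_,_])
open import Data.Sum.Function.Propositional using (_⊎-⇔_)
open import Function.Bundles using (_⇔_; mk⇔; Equivalence)
import Function.Properties.Equivalence as ⇔
open import Relation.Nullary using (¬_; yes; no)
open import Relation.Binary.PropositionalEquality using (_≡_; _≢_; refl; sym; trans; cong; cong₂; subst; module ≡-Reasoning)
open import Algebra.Properties.CommutativeSemigroup ℕ.+-commutativeSemigroup using (x∙yz≈y∙xz)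
import Data.Nat.Tactic.RingSolver as ℕ-Solver
import Data.Integer.Tactic.RingSolver as ℤ-Solver

open Equivalence using (to; from)

private
  variable
    P Q : ℤ → Set
    X Y : ℕ → Set
    a j j′ m n u u′ x : ℕ

HasSize-⇔ : (∀ z → P z ⇔ Q z) → HasSize P m → HasSize Q m
HasSize-⇔ P⇔Q (L , unique , len , ∈⇔P) = L , unique , len , λ z → ⇔.trans (∈⇔P z) (P⇔Q z)

HasSize-⊎ : HasSize P m → HasSize Q n → (∀ {z} → P z → ¬ Q z) →
            HasSize (λ z → P z ⊎ Q z) (m +ℕ n)
HasSize-⊎ (L , uL , refl , ∈L) (M , uM , refl , ∈M) disjoint =
  L ++ M ,
  Unique.++⁺ uL uM (λ (z∈L , z∈M) → disjoint (to (∈L _) z∈L) (to (∈M _) z∈M)) ,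
  length-++ L ,
  λ z → ⇔.trans ++-∈⇔ (∈L z ⊎-⇔ ∈M z)

⌜_⌝ : (ℕ → Set) → ℤ → Set
⌜ X ⌝ z = ∃ λ x → z ≡ + x × X x

HasSizeℕ-⇔ : (∀ x → X x ⇔ Y x) → HasSize ⌜ X ⌝ m → HasSize ⌜ Y ⌝ m
HasSizeℕ-⇔ X⇔Y = HasSize-⇔ λ z → mk⇔ (λ (x , z≡x , Xx) → x , z≡x , to (X⇔Y x) Xx)
                                     (λ (x , z≡x , Yx) → x , z≡x , from (X⇔Y x) Yx)

HasSizeℕ-⊥ : HasSize ⌜ (λ _ → ⊥) ⌝ 0
HasSizeℕ-⊥ = [] , [] , refl , λ z → mk⇔ (λ ()) (λ ())

HasSizeℕ-⊎ : HasSize ⌜ X ⌝ m → HasSize ⌜ Y ⌝ n → (∀ {x} → X x → ¬ Y x) →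
             HasSize ⌜ (λ x → X x ⊎ Y x) ⌝ (m +ℕ n)
HasSizeℕ-⊎ {Y = Y} sizeX sizeY disjoint =
  HasSize-⇔ (λ z → mk⇔ [ (λ (x , z≡x , Xx) → x , z≡x , inj₁ Xx) , (λ (y , z≡y , Yy) → y , z≡y , inj₂ Yy) ]
                       λ { (x , z≡x , inj₁ Xx) → inj₁ (x , z≡x , Xx) ; (y , z≡y , inj₂ Yy) → inj₂ (y , z≡y , Yy) })
            (HasSize-⊎ sizeX sizeY λ { (x , refl , Xx) (y , x≡y , Yy) → disjoint Xx (subst Y (sym (+-injective x≡y)) Yy) })

Interval : ℕ → ℕ → ℕ → Set
Interval a e x = a ≤ x × x ≤ a +ℕ e

HasSize-Interval : ∀ a e → HasSize ⌜ Interval a e ⌝ (suc e)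
HasSize-Interval a e =
  map shift (upTo (suc e)) ,
  Unique.map⁺ (λ eq → +-cancelˡ-≡ a _ _ (+-injective eq)) (Unique.upTo⁺ (suc e)) ,
  trans (length-map shift (upTo (suc e))) (length-upTo (suc e)) ,
  λ z → mk⇔ ∈⇒Interval Interval⇒∈
  where
  shift : ℕ → ℤ
  shift i = + (a +ℕ i)
  ∈⇒Interval : ∀ {z} → z ∈ map shift (upTo (suc e)) → ⌜ Interval a e ⌝ z
  ∈⇒Interval z∈ with i , i∈ , refl ← ∈-map⁻ shift z∈ = a +ℕ i , refl , m≤m+n a i , +-monoʳ-≤ a (≤-pred (∈-upTo⁻ i∈))
  Interval⇒∈ : ∀ {z} → ⌜ Interval a e ⌝ z → z ∈ map shift (upTo (suc e))
  Interval⇒∈ (x , refl , a≤x , x≤a+e) with d , refl ← m≤n⇒∃[o]m+o≡n a≤x =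
    ∈-map⁺ shift (∈-upTo⁺ (s≤s (+-cancelˡ-≤ a d e x≤a+e)))

tailSize : ℕ → ℕ → ℕ
tailSize c zero    = 0
tailSize c (suc u) = suc (u *ℕ c) +ℕ tailSize c u

module IntervalWithPoint (c b : ℕ) where

  A : List ℤ
  A = + b ∷ map +_ (upTo (suc c))

  A-isSetOfSize : c < b → IsSetOfSize A (suc (suc c))
  A-isSetOfSize c<b =
    tabulate b∉ ∷ Unique.map⁺ +-injective (Unique.upTo⁺ (suc c)) ,
    cong suc (trans (length-map +_ (upTo (suc c))) (length-upTo (suc c)))
    where
    b∉ : ∀ {z} → z ∈ map +_ (upTo (suc c)) → + b ≢ z
    b∉ z∈ b≡z with a , a∈ , refl ← ∈-map⁻ +_ z∈ =
      <⇒≱ c<b (≤-trans (≤-reflexive (+-injective b≡z)) (≤-pred (∈-upTo⁻ a∈)))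

  Block : ℕ → ℕ → ℕ → Set
  Block j u = Interval (j *ℕ b) (u *ℕ c)

  Blocks : ℕ → ℕ → Set
  Blocks h x = ∃₂ λ j u → j +ℕ u ≡ h × Block j u x

  Block-+b : Block j u x → Block (suc j) u (b +ℕ x)
  Block-+b {j} {u} (jb≤x , x≤) =
    +-monoʳ-≤ b jb≤x , ≤-trans (+-monoʳ-≤ b x≤) (≤-reflexive (sym (+-assoc b (j *ℕ b) (u *ℕ c))))

  Block-+small : a ≤ c → Block j u x → Block j (suc u) (a +ℕ x)
  Block-+small {a} {j} {u} {x} a≤c (jb≤x , x≤) =
    ≤-trans jb≤x (m≤n+m x a) , ≤-trans (+-mono-≤ a≤c x≤) (≤-reflexive (x∙yz≈y∙xz c (j *ℕ b) (u *ℕ c)))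

  sum-Blocks : ∀ xs → All (_∈ A) xs → ⌜ Blocks (length xs) ⌝ (sumℤ xs)
  sum-Blocks [] [] = 0 , refl , 0 , 0 , refl , z≤n , z≤n
  sum-Blocks (_ ∷ xs) (x∈A ∷ xs⊆A) with s , sum≡s , j , u , len , blk ← sum-Blocks xs xs⊆A | x∈A
  ... | here refl = b +ℕ s , cong (_+_ (+ b)) sum≡s , suc j , u , cong suc len , Block-+b {j} {u} blk
  ... | there x∈ with a , a∈ , refl ← ∈-map⁻ +_ x∈ =
    a +ℕ s , cong (_+_ (+ a)) sum≡s , j , suc u , trans (+-suc j u) (cong suc len) ,
    Block-+small {j = j} {u} (≤-pred (∈-upTo⁻ a∈)) blk

  Block-sum : ∀ j u t → t ≤ u *ℕ c → InSumset (j +ℕ u) A (+ (j *ℕ b +ℕ t))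
  Block-sum (suc j) u t t≤ with xs , len , xs⊆A , sum ← Block-sum j u t t≤ =
    + b ∷ xs , cong suc len , here refl ∷ xs⊆A ,
    trans (cong (_+_ (+ b)) sum) (cong +_ (sym (+-assoc b (j *ℕ b) t)))
  Block-sum zero zero zero _ = [] , refl , [] , refl
  Block-sum zero (suc u) t t≤ with xs , len , xs⊆A , sum ← Block-sum zero u (t ∸ c) (m≤n+o⇒m∸n≤o t c t≤) =
    + (c ⊓ t) ∷ xs , cong suc len , there (∈-map⁺ +_ (∈-upTo⁺ (s≤s (m⊓n≤m c t)))) ∷ xs⊆A ,
    trans (cong (_+_ (+ (c ⊓ t))) sum) (cong +_ (m⊓n+n∸m≡n c t))

  InSumset⇔Blocks : ∀ h z → InSumset h A z ⇔ ⌜ Blocks h ⌝ z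
  InSumset⇔Blocks h z = mk⇔ sum⇒Blocks Blocks⇒sum
    where
    sum⇒Blocks : InSumset h A z → ⌜ Blocks h ⌝ z
    sum⇒Blocks (xs , refl , xs⊆A , refl) = sum-Blocks xs xs⊆A
    Blocks⇒sum : ⌜ Blocks h ⌝ z → InSumset h A z
    Blocks⇒sum (x , refl , j , u , refl , jb≤x , x≤) with t , refl ← m≤n⇒∃[o]m+o≡n jb≤x =
      Block-sum j u t (+-cancelˡ-≤ (j *ℕ b) t (u *ℕ c) x≤)

  Block-end-mono : c ≤ b → j ≤ j′ → j +ℕ u ≡ j′ +ℕ u′ → j *ℕ b +ℕ u *ℕ c ≤ j′ *ℕ b +ℕ u′ *ℕ c
  Block-end-mono {j} {u = u} {u′} c≤b j≤j′ sum≡ with e , refl ← m≤n⇒∃[o]m+o≡n j≤j′ = begin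
    j *ℕ b +ℕ u *ℕ c          ≡⟨ cong (λ u → j *ℕ b +ℕ u *ℕ c) u≡ ⟩
    j *ℕ b +ℕ (e +ℕ u′) *ℕ c  ≡⟨ expand (j *ℕ b) e u′ c ⟩
    e *ℕ c +ℕ (j *ℕ b +ℕ u′ *ℕ c) ≤⟨ +-monoˡ-≤ _ (*-monoʳ-≤ e c≤b) ⟩
    e *ℕ b +ℕ (j *ℕ b +ℕ u′ *ℕ c) ≡⟨ collect j e u′ b c ⟩
    (j +ℕ e) *ℕ b +ℕ u′ *ℕ c  ∎
    where
    open ℕ.≤-Reasoning
    u≡ : u ≡ e +ℕ u′
    u≡ = +-cancelˡ-≡ j u (e +ℕ u′) (trans sum≡ (+-assoc j e u′))
    expand : ∀ y e u′ c → y +ℕ (e +ℕ u′) *ℕ c ≡ e *ℕ c +ℕ (y +ℕ u′ *ℕ c)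
    expand = ℕ-Solver.solve-∀
    collect : ∀ j e u′ b c → e *ℕ b +ℕ (j *ℕ b +ℕ u′ *ℕ c) ≡ (j +ℕ e) *ℕ b +ℕ u′ *ℕ c
    collect = ℕ-Solver.solve-∀

  <-next-block : ∀ {e} j → x ≤ j *ℕ b +ℕ e → e < b → x < suc j *ℕ b
  <-next-block {x} {e} j x≤ e<b = ≤-<-trans x≤ (<-≤-trans (+-monoʳ-< (j *ℕ b) e<b) (≤-reflexive (+-comm (j *ℕ b) b)))

  -- Tail q r is the union of the blocks [jb, jb + uc] with j + u = q + r and j > q.
  Tail : ℕ → ℕ → ℕ → Set
  Tail j zero    x = ⊥
  Tail j (suc u) x = Block (suc j) u x ⊎ Tail (suc j) u x

  Tail-lower : ∀ j u → Tail j u x → suc j *ℕ b ≤ x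
  Tail-lower j (suc u) (inj₁ (lower , _)) = lower
  Tail-lower j (suc u) (inj₂ tail)        = ≤-trans (*-monoˡ-≤ b (n≤1+n (suc j))) (Tail-lower (suc j) u tail)

  HasSize-Tail : ∀ j u → u *ℕ c < b → HasSize ⌜ Tail j u ⌝ (tailSize c u)
  HasSize-Tail j zero    _    = HasSizeℕ-⊥
  HasSize-Tail j (suc u) uc<b =
    HasSizeℕ-⊎ (HasSize-Interval (suc j *ℕ b) (u *ℕ c)) (HasSize-Tail (suc j) u u′c<b) separated
    where
    u′c<b : u *ℕ c < b
    u′c<b = ≤-<-trans (m≤n+m (u *ℕ c) c) uc<b
    separated : Block (suc j) u x → ¬ Tail (suc j) u x
    separated (_ , x≤) tail = <⇒≱ (<-next-block (suc j) x≤ u′c<b) (Tail-lower (suc j) u tail)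

  Block⇒Tail : ∀ q r → q < j → j +ℕ u ≡ q +ℕ r → Block j u x → Tail q r x
  Block⇒Tail {j} {u} q zero q<j sum≡ _ = <⇒≱ q<j (≤-trans (m≤m+n j u) (≤-reflexive (trans sum≡ (ℕ.+-identityʳ q))))
  Block⇒Tail {j} {u} q (suc r) q<j sum≡ blk with m≤n⇒m<n∨m≡n q<j
  ... | inj₁ q+1<j = inj₂ (Block⇒Tail (suc q) r q+1<j (trans sum≡ (+-suc q r)) blk)
  ... | inj₂ refl  = inj₁ (subst (λ u → Block (suc q) u _) u≡r blk)
    where
    u≡r : u ≡ r
    u≡r = +-cancelˡ-≡ q u r (suc-injective (trans sum≡ (+-suc q r)))

  Tail⇒Blocks : ∀ q r → Tail q r x → Blocks (q +ℕ r) x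
  Tail⇒Blocks q (suc r) (inj₁ blk)  = suc q , r , sym (+-suc q r) , blk
  Tail⇒Blocks {x} q (suc r) (inj₂ tail) = subst (λ h → Blocks h x) (sym (+-suc q r)) (Tail⇒Blocks (suc q) r tail)

  Interval⇒Blocks : ∀ q r → b ≤ suc (suc r *ℕ c) → x ≤ q *ℕ b +ℕ r *ℕ c → Blocks (q +ℕ r) x
  Interval⇒Blocks zero    r _   x≤ = 0 , r , refl , z≤n , x≤
  Interval⇒Blocks {x} (suc q) r b≤ x≤ with x ≤? q *ℕ b +ℕ suc r *ℕ c
  ... | yes x≤′ = subst (λ h → Blocks h x) (+-suc q r) (Interval⇒Blocks q (suc r) b≤′ x≤′)
    where
    b≤′ : b ≤ suc (suc (suc r) *ℕ c)
    b≤′ = ≤-trans b≤ (s≤s (*-monoˡ-≤ c (n≤1+n (suc r))))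
  ... | no x≰  = suc q , r , refl , lower , x≤
    where
    lower : suc q *ℕ b ≤ x
    lower = ≤-trans (+-monoˡ-≤ (q *ℕ b) b≤) (≤-trans (≤-reflexive (cong suc (+-comm (suc r *ℕ c) (q *ℕ b)))) (≰⇒> x≰))

  Blocks⇔ : ∀ q r → c ≤ b → b ≤ suc (suc r *ℕ c) →
            ∀ x → Blocks (q +ℕ r) x ⇔ (Interval 0 (q *ℕ b +ℕ r *ℕ c) x ⊎ Tail q r x)
  Blocks⇔ q r c≤b b≤ x = mk⇔ split (λ { (inj₁ (_ , x≤)) → Interval⇒Blocks q r b≤ x≤ ; (inj₂ tail) → Tail⇒Blocks q r tail })
    where
    split : Blocks (q +ℕ r) x → Interval 0 (q *ℕ b +ℕ r *ℕ c) x ⊎ Tail q r x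
    split (j , u , sum≡ , blk@(_ , x≤)) with j ≤? q
    ... | yes j≤q = inj₁ (z≤n , ≤-trans x≤ (Block-end-mono c≤b j≤q sum≡))
    ... | no j≰q  = inj₂ (Block⇒Tail q r (≰⇒> j≰q) sum≡ blk)

  HasSize-sumset : ∀ q r → c ≤ b → r *ℕ c < b → b ≤ suc (suc r *ℕ c) →
                   HasSize (InSumset (q +ℕ r) A) (suc (q *ℕ b +ℕ r *ℕ c) +ℕ tailSize c r)
  HasSize-sumset q r c≤b rc<b b≤ =
    HasSize-⇔ (λ z → ⇔.sym (InSumset⇔Blocks (q +ℕ r) z))
      (HasSizeℕ-⇔ (λ x → ⇔.sym (Blocks⇔ q r c≤b b≤ x))
        (HasSizeℕ-⊎ (HasSize-Interval 0 (q *ℕ b +ℕ r *ℕ c)) (HasSize-Tail q r rc<b) separated))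
    where
    separated : Interval 0 (q *ℕ b +ℕ r *ℕ c) x → ¬ Tail q r x
    separated (_ , x≤) tail = <⇒≱ (<-next-block q x≤ rc<b) (Tail-lower q r tail)

  InRZ-A : ∀ q r → c < b → r *ℕ c < b → b ≤ suc (suc r *ℕ c) →
           InRZ (q +ℕ r) (suc (suc c)) (suc (q *ℕ b +ℕ r *ℕ c) +ℕ tailSize c r)
  InRZ-A q r c<b rc<b b≤ = A , A-isSetOfSize c<b , HasSize-sumset q r (<⇒≤ c<b) rc<b b≤

tailSize-double : ∀ c r → + 2 * + tailSize c r ≡ + r * + r * + c + + 2 * + r - + r * + c
tailSize-double c zero    = refl
tailSize-double c (suc r) = begin
  + 2 * (+ 1 + + (r *ℕ c) + T)                       ≡⟨ cong (λ y → + 2 * (+ 1 + y + T)) (pos-* r c) ⟩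
  + 2 * (+ 1 + R * C + T)                            ≡⟨ distrib R C T ⟩
  + 2 + + 2 * (R * C) + + 2 * T                      ≡⟨ cong (_+_ (+ 2 + + 2 * (R * C))) (tailSize-double c r) ⟩
  + 2 + + 2 * (R * C) + (R * R * C + + 2 * R - R * C) ≡⟨ regroup R C ⟩
  (+ 1 + R) * (+ 1 + R) * C + + 2 * (+ 1 + R) - (+ 1 + R) * C ∎
  where
  open ≡-Reasoning
  R C T : ℤ
  R = + r
  C = + c
  T = + tailSize c r
  distrib : ∀ R C T → + 2 * (+ 1 + R * C + T) ≡ + 2 + + 2 * (R * C) + + 2 * T
  distrib = ℤ-Solver.solve-∀
  regroup : ∀ R C → + 2 + + 2 * (R * C) + (R * R * C + + 2 * R - R * C) ≡
                    (+ 1 + R) * (+ 1 + R) * C + + 2 * (+ 1 + R) - (+ 1 + R) * C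
  regroup = ℤ-Solver.solve-∀

twiceAP : ℤ → ℤ → ℤ → ℤ → ℤ
twiceAP h k i b = + 2 * ((i + + 1) * b) + + 2 * ((h - i) * (h * (k - + 2) + + 1)) - (h + i + + 1) * (h - i) * (k - + 2)

pos-between : ∀ {i} → + m ≤ℤ i → i ≤ℤ + n → ∃ λ B → i ≡ + B × m ≤ B × B ≤ n
pos-between (+≤+ m≤B) (+≤+ B≤n) = _ , refl , m≤B , B≤n

module Progression (i₀ p c′ : ℕ) where
  private
    h k q r c : ℕ
    h = i₀ +ℕ 2 +ℕ p
    k = 3 +ℕ c′
    q = suc i₀
    r = suc p
    c = suc c′

  low≡ : (+ h - + i₀) * (+ k - + 2) - (+ k - + 3) ≡ + suc (r *ℕ c)
  low≡ = trans (poly (+ i₀) (+ p) (+ c′)) (cong (_+_ (+ 1)) (sym (pos-* r c)))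
    where
    poly : ∀ I P C′ → (I + + 2 + P - I) * (+ 3 + C′ - + 2) - (+ 3 + C′ - + 3) ≡ + 1 + (+ 1 + P) * (+ 1 + C′)
    poly = ℤ-Solver.solve-∀

  high≡ : (+ h - + i₀) * (+ k - + 2) ≡ + (suc r *ℕ c)
  high≡ = trans (poly (+ i₀) (+ p) (+ c′)) (sym (pos-* (suc r) c))
    where
    poly : ∀ I P C′ → (I + + 2 + P - I) * (+ 3 + C′ - + 2) ≡ (+ 1 + (+ 1 + P)) * (+ 1 + C′)
    poly = ℤ-Solver.solve-∀

  size : ℕ → ℕ
  size B = suc (q *ℕ B +ℕ r *ℕ c) +ℕ tailSize c r

  twiceAP-size : ∀ B → twiceAP (+ h) (+ k) (+ i₀) (+ B) ≡ + 2 * + size B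
  twiceAP-size B = begin
    twiceAP (+ h) (+ k) (+ i₀) (+ B)             ≡⟨ poly (+ i₀) (+ p) (+ c′) (+ B) ⟩
    + 2 * E + (R * R * C + + 2 * R - R * C)     ≡⟨ cong (_+_ (+ 2 * E)) (sym (tailSize-double c r)) ⟩
    + 2 * E + + 2 * T                           ≡⟨ factor E T ⟩
    + 2 * (E + T)                               ≡⟨ cong (λ y → + 2 * (+ 1 + y + T)) (sym (cong₂ _+_ (pos-* q B) (pos-* r c))) ⟩
    + 2 * + size B                              ∎
    where
    open ≡-Reasoning
    R C T E : ℤ
    R = + r
    C = + c
    T = + tailSize c r
    E = + 1 + (+ q * + B + R * C)
    poly : ∀ I P C′ B →
           + 2 * ((I + + 1) * B) + + 2 * ((I + + 2 + P - I) * ((I + + 2 + P) * (+ 3 + C′ - + 2) + + 1))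
             - (I + + 2 + P + I + + 1) * (I + + 2 + P - I) * (+ 3 + C′ - + 2)
           ≡ + 2 * (+ 1 + ((+ 1 + I) * B + (+ 1 + P) * (+ 1 + C′)))
             + ((+ 1 + P) * (+ 1 + P) * (+ 1 + C′) + + 2 * (+ 1 + P) - (+ 1 + P) * (+ 1 + C′))
    poly = ℤ-Solver.solve-∀
    factor : ∀ X T → + 2 * X + + 2 * T ≡ + 2 * (X + T)
    factor = ℤ-Solver.solve-∀

  InRZ-size : ∀ B → r *ℕ c < B → B ≤ suc r *ℕ c → InRZ h k (size B)
  InRZ-size B rc<B B≤ =
    subst (λ h → InRZ h k (size B)) (q+r≡h i₀ p)
      (IntervalWithPoint.InRZ-A c B q r (≤-<-trans (m≤m+n c (p *ℕ c)) rc<B) rc<B (m≤n⇒m≤1+n B≤))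
    where
    q+r≡h : ∀ i₀ p → suc i₀ +ℕ suc p ≡ i₀ +ℕ 2 +ℕ p
    q+r≡h = ℕ-Solver.solve-∀

  AP-⊆-RZ : ∀ b → (+ h - + i₀) * (+ k - + 2) - (+ k - + 3) ≤ℤ b → b ≤ℤ (+ h - + i₀) * (+ k - + 2) →
            ∀ n → + 2 * n ≡ twiceAP (+ h) (+ k) (+ i₀) b → InRZℤ h k n
  AP-⊆-RZ b lo hi n n≡ with B , refl , rc<B , B≤ ← pos-between (subst (_≤ℤ b) low≡ lo) (subst (b ≤ℤ_) high≡ hi) =
    size B , *-cancelˡ-≡ (+ 2) n (+ size B) (trans n≡ (twiceAP-size B)) , InRZ-size B rc<B B≤

progression-⊆-RZ : (h k : ℕ) → 3 ≤ k → (i₀ : ℕ) → i₀ +ℕ 2 ≤ h → (b : ℤ) →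
                   (+ h - + i₀) * (+ k - + 2) - (+ k - + 3) ≤ℤ b → b ≤ℤ (+ h - + i₀) * (+ k - + 2) →
                   (n : ℤ) → + 2 * n ≡ twiceAP (+ h) (+ k) (+ i₀) b → InRZℤ h k n
progression-⊆-RZ h k 3≤k i₀ i₀+2≤h with p , refl ← m≤n⇒∃[o]m+o≡n i₀+2≤h | c′ , refl ← m≤n⇒∃[o]m+o≡n 3≤k =
  Progression.AP-⊆-RZ i₀ p c′

tailSize-origin : ∀ h c′ → + h * + h * (+ (3 +ℕ c′) - + 2) + + 4 * + h - + h * + (3 +ℕ c′) ≡ + 2 * + tailSize (suc c′) h
tailSize-origin h c′ = trans (poly (+ h) (+ c′)) (sym (tailSize-double (suc c′) h))
  where
  poly : ∀ H C′ → H * H * (+ 3 + C′ - + 2) + + 4 * H - H * (+ 3 + C′) ≡ H * H * (+ 1 + C′) + + 2 * H - H * (+ 1 + C′)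
  poly = ℤ-Solver.solve-∀

≤-halve : ∀ {a b x y} → a ≤ℤ b → b - a ≡ + 2 * (y - x) → x ≤ℤ y
≤-halve a≤b b-a≡ = 0≤i-j⇒j≤i (*-cancelˡ-≤-pos 0ℤ _ (+ 2) (subst (0ℤ ≤ℤ_) b-a≡ (i≤j⇒0≤j-i a≤b)))

interval-in-progression :
  ∀ H K N₀ n → H * H * (K - + 2) + + 4 * H - H * K ≡ + 2 * N₀ →
  H * H * (K - + 2) + H * K - + 2 * K + + 6 ≤ℤ + 2 * n → + 2 * n ≤ℤ H * H * (K - + 2) + H * K →
  (H - 0ℤ) * (K - + 2) - (K - + 3) ≤ℤ n - N₀ × n - N₀ ≤ℤ (H - 0ℤ) * (K - + 2) × + 2 * n ≡ twiceAP H K 0ℤ (n - N₀)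
interval-in-progression H K N₀ n origin low≤ ≤high = ≤-halve low≤ low-gap , ≤-halve ≤high high-gap , on-progression
  where
  open ≡-Reasoning
  Φ₀ Lo Hi : ℤ
  Φ₀ = H * H * (K - + 2) + + 4 * H - H * K   -- twiceAP H K 0ℤ 0ℤ
  Lo = (H - 0ℤ) * (K - + 2) - (K - + 3)
  Hi = (H - 0ℤ) * (K - + 2)
  cancel : ∀ X Y → X + (Y - Y) ≡ X
  cancel X Y = trans (cong (_+_ X) (+-inverseʳ Y)) (+-identityʳ X)
  low-gap : + 2 * n - (H * H * (K - + 2) + H * K - + 2 * K + + 6) ≡ + 2 * ((n - N₀) - Lo)
  low-gap = begin
    + 2 * n - (H * H * (K - + 2) + H * K - + 2 * K + + 6) ≡⟨ poly H K N₀ n ⟩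
    + 2 * ((n - N₀) - Lo) + (+ 2 * N₀ - Φ₀)               ≡⟨ cong (λ t → + 2 * ((n - N₀) - Lo) + (+ 2 * N₀ - t)) origin ⟩
    + 2 * ((n - N₀) - Lo) + (+ 2 * N₀ - + 2 * N₀)          ≡⟨ cancel _ (+ 2 * N₀) ⟩
    + 2 * ((n - N₀) - Lo)                                  ∎
    where
    poly : ∀ H K N₀ n → + 2 * n - (H * H * (K - + 2) + H * K - + 2 * K + + 6)
                        ≡ + 2 * ((n - N₀) - ((H - 0ℤ) * (K - + 2) - (K - + 3)))
                          + (+ 2 * N₀ - (H * H * (K - + 2) + + 4 * H - H * K))
    poly = ℤ-Solver.solve-∀
  high-gap : H * H * (K - + 2) + H * K - + 2 * n ≡ + 2 * (Hi - (n - N₀))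
  high-gap = begin
    H * H * (K - + 2) + H * K - + 2 * n           ≡⟨ poly H K N₀ n ⟩
    + 2 * (Hi - (n - N₀)) + (Φ₀ - + 2 * N₀)        ≡⟨ cong (λ t → + 2 * (Hi - (n - N₀)) + (t - + 2 * N₀)) origin ⟩
    + 2 * (Hi - (n - N₀)) + (+ 2 * N₀ - + 2 * N₀)  ≡⟨ cancel _ (+ 2 * N₀) ⟩
    + 2 * (Hi - (n - N₀))                          ∎
    where
    poly : ∀ H K N₀ n → H * H * (K - + 2) + H * K - + 2 * n
                        ≡ + 2 * ((H - 0ℤ) * (K - + 2) - (n - N₀)) + ((H * H * (K - + 2) + + 4 * H - H * K) - + 2 * N₀)
    poly = ℤ-Solver.solve-∀
  on-progression : + 2 * n ≡ twiceAP H K 0ℤ (n - N₀)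
  on-progression = sym (begin
    twiceAP H K 0ℤ (n - N₀)    ≡⟨ poly H K N₀ n ⟩
    + 2 * (n - N₀) + Φ₀        ≡⟨ cong (_+_ (+ 2 * (n - N₀))) origin ⟩
    + 2 * (n - N₀) + + 2 * N₀  ≡⟨ poly′ N₀ n ⟩
    + 2 * n                    ∎)
    where
    poly : ∀ H K N₀ n → + 2 * ((0ℤ + + 1) * (n - N₀)) + + 2 * ((H - 0ℤ) * (H * (K - + 2) + + 1))
                          - (H + 0ℤ + + 1) * (H - 0ℤ) * (K - + 2)
                        ≡ + 2 * (n - N₀) + (H * H * (K - + 2) + + 4 * H - H * K)
    poly = ℤ-Solver.solve-∀
    poly′ : ∀ N₀ n → + 2 * (n - N₀) + + 2 * N₀ ≡ + 2 * n
    poly′ = ℤ-Solver.solve-∀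

interval-⊆-RZ : (h k : ℕ) → 2 ≤ h → 3 ≤ k → (n : ℤ) →
                + h * + h * (+ k - + 2) + + h * + k - + 2 * + k + + 6 ≤ℤ + 2 * n →
                + 2 * n ≤ℤ + h * + h * (+ k - + 2) + + h * + k → InRZℤ h k n
interval-⊆-RZ h k 2≤h 3≤k n low≤ ≤high
  with c′ , refl ← m≤n⇒∃[o]m+o≡n 3≤k
  with lo , hi , n≡ ← interval-in-progression (+ h) (+ k) (+ tailSize (suc c′) h) n (tailSize-origin h c′) low≤ ≤high
  = progression-⊆-RZ h k 3≤k 0 2≤h _ lo hi n n≡

mainTheorem10 : (h k : ℕ) → 2 ≤ h → 3 ≤ k →
    ((i₀ : ℕ) → i₀ +ℕ 2 ≤ h → (b : ℤ) →
      ((+ h - + i₀) * (+ k - + 2) - (+ k - + 3)) ≤ℤ b → b ≤ℤ ((+ h - + i₀) * (+ k - + 2)) →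
      (n : ℤ) →
      + 2 * n ≡ + 2 * ((+ i₀ + + 1) * b) + + 2 * ((+ h - + i₀) * (+ h * (+ k - + 2) + + 1))
                - (+ h + + i₀ + + 1) * (+ h - + i₀) * (+ k - + 2) →
      InRZℤ h k n)
    ×
    ((n : ℤ) →
      (+ h * + h * (+ k - + 2) + + h * + k - + 2 * + k + + 6) ≤ℤ + 2 * n →
      + 2 * n ≤ℤ (+ h * + h * (+ k - + 2) + + h * + k) →
      InRZℤ h k n)
mainTheorem10 h k 2≤h 3≤k = progression-⊆-RZ h k 3≤k , interval-⊆-RZ h k 2≤h 3≤k
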